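{- Let $\Gamma$ be a $2$-dimensional simplicial complex. Suppose there is a vertex $v$ such that $\mathrm{link}_\Gamma(\{v\})$ contains nonboundary edges of $\Gamma$, $\Gamma\setminus\{v\}$ is shellable, and the nonboundary edges of $\Gamma$ lying in $\mathrm{link}_\Gamma(\{v\})$ do not form a connected graph. Then $\Gamma$ is not shellable.
   Context: A simplicial complex is a family of subsets of a finite set closed under taking subsets; edges are 2-element faces. $\mathrm{link}_\Gamma(\tau)=\{\eta\in\Gamma:\eta\cap\tau=\emptyset,\eta\cup\tau\in\Gamma\}$. $\Gamma\setminus\{v\}$ is the subcomplex of faces of $\Gamma$ not containing $v$. In a $2$-dimensional complex, an edge is a nonboundary edge if it is contained in at least two $2$-dimensional faces, and a boundary edge otherwise. Shellable (nonpure sense): there is an ordering $\sigma_1,\dots,\sigma_t$ of all facets such that for each $j\ge2$, $(\bigcup_{i<j}\overline{\sigma_i})\cap\overline{\sigma_j}$ is a pure $(\dim\sigma_j-1)$-dimensional complex, $\overline\sigma$ being the set of subsets of $\sigma$. -}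

module Defs where

open import Data.Nat using (ℕ; _≤_; _∸_)
open import Data.Fin using (Fin)
open import Data.Fin.Subset using (Subset; _⊆_; _∈_; _∉_; ∣_∣; ⁅_⁆; _∪_)
open import Data.List using (List; []; _∷_; _++_)
open import Data.List.Relation.Unary.Any using (Any)
open import Data.List.Relation.Unary.Unique.Propositional using (Unique)
import Data.List.Membership.Propositional as LM
open import Data.Product using (Σ; ∃; ∃-syntax; _×_; _,_)
open import Data.Sum using (inj₁; inj₂)
open import Data.Fin.Subset.Properties using (x∈p∪q⁻; x∈p∪q⁺)
open import Relation.Binary.PropositionalEquality using (_≡_; _≢_)
open import Relation.Nullary using (¬_)

record Complex (n : ℕ) : Set₁ where
  field
    face   : Subset n → Set
    closed : ∀ {σ τ} → τ ⊆ σ → face σ → face τ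
open Complex public

Maximal : ∀ {n} → (Subset n → Set) → Subset n → Set
Maximal K σ = K σ × (∀ τ → K τ → σ ⊆ τ → τ ≡ σ)

Facet : ∀ {n} → Complex n → Subset n → Set
Facet Γ = Maximal (face Γ)

TwoDimensional : ∀ {n} → Complex n → Set
TwoDimensional Γ = (∃[ σ ] (face Γ σ × ∣ σ ∣ ≡ 3)) × (∀ σ → face Γ σ → ∣ σ ∣ ≤ 3)

link : ∀ {n} → Complex n → Fin n → Complex n
face   (link Γ v) η = v ∉ η × face Γ (η ∪ ⁅ v ⁆)
closed (link Γ v) {σ} {τ} τ⊆σ (v∉σ , f) =
  (λ v∈τ → v∉σ (τ⊆σ v∈τ)) , closed Γ (λ {x} → ∪⊆ x) f
  where
  ∪⊆ : ∀ x → x ∈ (τ ∪ ⁅ v ⁆) → x ∈ (σ ∪ ⁅ v ⁆)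
  ∪⊆ x x∈ with x∈p∪q⁻ τ ⁅ v ⁆ x∈
  ... | inj₁ p = x∈p∪q⁺ (inj₁ (τ⊆σ p))
  ... | inj₂ q = x∈p∪q⁺ (inj₂ q)

delete : ∀ {n} → Complex n → Fin n → Complex n
face   (delete Γ v) σ = v ∉ σ × face Γ σ
closed (delete Γ v) τ⊆σ (v∉σ , f) = (λ v∈τ → v∉σ (τ⊆σ v∈τ)) , closed Γ τ⊆σ f

Edge : ∀ {n} → Complex n → Subset n → Set
Edge Γ e = face Γ e × ∣ e ∣ ≡ 2

NonboundaryEdge : ∀ {n} → Complex n → Subset n → Set
NonboundaryEdge Γ e =
  Edge Γ e ×
  (∃[ σ₁ ] ∃[ σ₂ ] (σ₁ ≢ σ₂ × face Γ σ₁ × ∣ σ₁ ∣ ≡ 3 × e ⊆ σ₁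
                             × face Γ σ₂ × ∣ σ₂ ∣ ≡ 3 × e ⊆ σ₂))

LinkNBEdge : ∀ {n} → Complex n → Fin n → Subset n → Set
LinkNBEdge Γ v e = face (link Γ v) e × NonboundaryEdge Γ e

GraphVertex : ∀ {n} → (Subset n → Set) → Fin n → Set
GraphVertex E a = ∃[ e ] (E e × a ∈ e)

data Reach {n} (E : Subset n → Set) : Fin n → Fin n → Set where
  here : ∀ {a} → Reach E a a
  step : ∀ {a b c} → E (⁅ a ⁆ ∪ ⁅ b ⁆) → Reach E b c → Reach E a c

Connected : ∀ {n} → (Subset n → Set) → Set
Connected E = ∀ a b → GraphVertex E a → GraphVertex E b → Reach E a b

-- A family K of subsets is pure with all facets of cardinality c
-- (i.e. pure of dimension c - 1).
PureCard : ∀ {n} → (Subset n → Set) → ℕ → Set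
PureCard K c = ∀ τ → Maximal K τ → ∣ τ ∣ ≡ c

-- (⋃_{ρ ∈ ps} closure ρ) ∩ closure σ
PrefixIntersection : ∀ {n} → List (Subset n) → Subset n → Subset n → Set
PrefixIntersection ps σ τ = τ ⊆ σ × Any (τ ⊆_) ps

-- Shelling (nonpure sense): an ordering of all facets (each exactly once)
-- such that for every σ_j with j ≥ 2, (⋃_{i<j} ‾σ_i) ∩ ‾σ_j is pure of
-- dimension dim σ_j - 1, i.e. all its facets have |σ_j| - 1 elements.
record Shelling {n} (Γ : Complex n) : Set where
  field
    order      : List (Subset n)
    unique     : Unique order
    facets⊆    : ∀ σ → σ LM.∈ order → Facet Γ σ
    ⊆facets    : ∀ σ → Facet Γ σ → σ LM.∈ order
    condition  : ∀ ps σ qs → order ≡ ps ++ σ ∷ qs → ps ≢ [] →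
                 PureCard (PrefixIntersection ps σ) (∣ σ ∣ ∸ 1)

Shellable : ∀ {n} → Complex n → Set
Shellable Γ = Shelling Γ

-- Suppose Γ is shellable. Call a triangle an apex triangle if it contains v and a base triangle
-- otherwise. Along the shelling we keep the invariant: two vertices of shelled apex triangles that
-- are joined through shelled base triangles are joined by nonboundary link edges. It survives each
-- step because a newly shelled triangle meets the earlier facets in a pure 1-dimensional complex,
-- hence shares an edge with an earlier triangle, and an edge shared by an apex and a base triangle
-- is a nonboundary edge of the link. Finally, every vertex of a nonboundary link edge lies on an
-- apex triangle and, through the second triangle on that edge, on a triangle of Γ ∖ v; the
-- triangles of Γ ∖ v are connected through shared vertices since Γ ∖ v is shellable. So the
-- nonboundary link edges would form a connected graph.

module Submission where

open import Defs
open import Data.Nat using (suc; s≤s; _≤_; _∸_; _≤?_; _≟_)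
open import Data.Nat.Properties using (≤-antisym; ≰⇒>; <⇒≱)
open import Data.Fin using (Fin; zero; suc) renaming (_≟_ to _≟ᶠ_)
open import Data.Fin.Properties using (any?)
open import Data.Fin.Subset using (Subset; _⊆_; _∈_; _∉_; ∣_∣; ⁅_⁆; _∪_; ⊥; inside; outside)
open import Data.Fin.Subset.Properties
  using (x∈p∪q⁻; p⊆p∪q; q⊆p∪q; ∪-identityʳ; x∈⁅x⁆; x∈⁅y⁆⇒x≡y; x∉⁅y⁆⇒x≢y; ∣⁅x⁆∣≡1; ∣⊥∣≡0;
         ⊆-trans; ⊆-antisym; ⊥⊆; p⊂q⇒∣p∣<∣q∣; _∈?_; _⊆?_)
open import Data.Vec using (_∷_; here; there)
open import Data.List using (List; []; _∷_; _++_; _∷ʳ_)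
open import Data.List.Properties using (++-assoc; ++-identityʳ)
open import Data.List.Relation.Unary.Any using (Any; here; there)
import Data.List.Relation.Unary.Any as Any
open import Data.List.Relation.Unary.Any.Properties using (¬Any[])
import Data.List.Membership.Propositional as List
open import Data.List.Membership.Propositional.Properties using (∈-++⁺ˡ; ∈-++⁺ʳ; ∈-++⁻)
open import Data.Product using (∃-syntax; _×_; _,_; proj₁; proj₂)
open import Data.Sum using (_⊎_; inj₁; inj₂)
open import Relation.Binary.Construct.Closure.ReflexiveTransitive using (Star; ε; _◅_; _◅◅_)
import Relation.Binary.Construct.Closure.ReflexiveTransitive as Star
open import Relation.Binary.PropositionalEquality using (_≡_; _≢_; refl; sym; trans; cong; subst)
open import Relation.Nullary using (¬_; yes; no; contradiction)
open import Relation.Nullary.Decidable using (_×-dec_; ¬?)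
open import Function using (id)

∪-least : ∀ {n} {p q r : Subset n} → p ⊆ r → q ⊆ r → p ∪ q ⊆ r
∪-least {p = p} {q} p⊆r q⊆r x∈p∪q with x∈p∪q⁻ p q x∈p∪q
... | inj₁ x∈p = p⊆r x∈p
... | inj₂ x∈q = q⊆r x∈q

x∈p⇒⁅x⁆⊆p : ∀ {n} {x : Fin n} {p} → x ∈ p → ⁅ x ⁆ ⊆ p
x∈p⇒⁅x⁆⊆p x∈p y∈⁅x⁆ = subst (_∈ _) (sym (x∈⁅y⁆⇒x≡y _ y∈⁅x⁆)) x∈p

∣p∪⁅x⁆∣≡1+∣p∣ : ∀ {n} (p : Subset n) {x} → x ∉ p → ∣ p ∪ ⁅ x ⁆ ∣ ≡ suc ∣ p ∣
∣p∪⁅x⁆∣≡1+∣p∣ (outside ∷ p) {zero}  _   = cong suc (cong ∣_∣ (∪-identityʳ p))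
∣p∪⁅x⁆∣≡1+∣p∣ (inside  ∷ p) {zero}  x∉p = contradiction here x∉p
∣p∪⁅x⁆∣≡1+∣p∣ (outside ∷ p) {suc x} x∉p = ∣p∪⁅x⁆∣≡1+∣p∣ p (λ x∈p → x∉p (there x∈p))
∣p∪⁅x⁆∣≡1+∣p∣ (inside  ∷ p) {suc x} x∉p = cong suc (∣p∪⁅x⁆∣≡1+∣p∣ p (λ x∈p → x∉p (there x∈p)))

x≢y⇒∣⁅x⁆∪⁅y⁆∣≡2 : ∀ {n} {x y : Fin n} → x ≢ y → ∣ ⁅ x ⁆ ∪ ⁅ y ⁆ ∣ ≡ 2
x≢y⇒∣⁅x⁆∪⁅y⁆∣≡2 {x = x} x≢y =
  trans (∣p∪⁅x⁆∣≡1+∣p∣ ⁅ x ⁆ (λ y∈⁅x⁆ → x≢y (sym (x∈⁅y⁆⇒x≡y x y∈⁅x⁆)))) (cong suc (∣⁅x⁆∣≡1 x))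

p⊆q∧∣q∣≤∣p∣⇒q⊆p : ∀ {n} {p q : Subset n} → p ⊆ q → ∣ q ∣ ≤ ∣ p ∣ → q ⊆ p
p⊆q∧∣q∣≤∣p∣⇒q⊆p {p = p} p⊆q ∣q∣≤∣p∣ {x} x∈q with x ∈? p
... | yes x∈p = x∈p
... | no  x∉p = contradiction ∣q∣≤∣p∣ (<⇒≱ (p⊂q⇒∣p∣<∣q∣ (p⊆q , x , x∈q , x∉p)))

∣p∣≤3⇒elements : ∀ {n} {p : Subset n} {x y w z} → ∣ p ∣ ≤ 3 →
  x ∈ p → y ∈ p → w ∈ p → x ≢ y → x ≢ w → y ≢ w → z ∈ p → z ≡ x ⊎ z ≡ y ⊎ z ≡ w
∣p∣≤3⇒elements {p = p} {x} {y} {w} ∣p∣≤3 x∈p y∈p w∈p x≢y x≢w y≢w z∈p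
  with x∈p∪q⁻ (⁅ x ⁆ ∪ ⁅ y ⁆) ⁅ w ⁆ (p⊆q∧∣q∣≤∣p∣⇒q⊆p xyw⊆p (subst (_ ≤_) (sym ∣xyw∣≡3) ∣p∣≤3) z∈p)
  where
  xyw⊆p : (⁅ x ⁆ ∪ ⁅ y ⁆) ∪ ⁅ w ⁆ ⊆ p
  xyw⊆p = ∪-least (∪-least (x∈p⇒⁅x⁆⊆p x∈p) (x∈p⇒⁅x⁆⊆p y∈p)) (x∈p⇒⁅x⁆⊆p w∈p)
  w∉xy : w ∉ ⁅ x ⁆ ∪ ⁅ y ⁆
  w∉xy w∈xy with x∈p∪q⁻ ⁅ x ⁆ ⁅ y ⁆ w∈xy
  ... | inj₁ w∈⁅x⁆ = x≢w (sym (x∈⁅y⁆⇒x≡y x w∈⁅x⁆))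
  ... | inj₂ w∈⁅y⁆ = y≢w (sym (x∈⁅y⁆⇒x≡y y w∈⁅y⁆))
  ∣xyw∣≡3 : ∣ (⁅ x ⁆ ∪ ⁅ y ⁆) ∪ ⁅ w ⁆ ∣ ≡ 3
  ∣xyw∣≡3 = trans (∣p∪⁅x⁆∣≡1+∣p∣ _ w∉xy) (cong suc (x≢y⇒∣⁅x⁆∪⁅y⁆∣≡2 x≢y))
... | inj₂ z∈⁅w⁆ = inj₂ (inj₂ (x∈⁅y⁆⇒x≡y w z∈⁅w⁆))
... | inj₁ z∈xy with x∈p∪q⁻ ⁅ x ⁆ ⁅ y ⁆ z∈xy
...   | inj₁ z∈⁅x⁆ = inj₁ (x∈⁅y⁆⇒x≡y x z∈⁅x⁆)
...   | inj₂ z∈⁅y⁆ = inj₂ (inj₁ (x∈⁅y⁆⇒x≡y y z∈⁅y⁆))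

∈-∷ʳ⁻ : ∀ {a} {A : Set a} {x y : A} xs → x List.∈ xs ∷ʳ y → x List.∈ xs ⊎ x ≡ y
∈-∷ʳ⁻ xs x∈xs∷ʳy with ∈-++⁻ xs x∈xs∷ʳy
... | inj₁ x∈xs       = inj₁ x∈xs
... | inj₂ (here x≡y) = inj₂ x≡y

prefix-induction : ∀ {a p} {A : Set a} (P : List A → Set p) {xs : List A} → P [] →
  (∀ ps x qs → xs ≡ ps ++ x ∷ qs → P ps → P (ps ∷ʳ x)) → P xs
prefix-induction P {xs} P[] extend = go [] xs refl P[]
  where
  go : ∀ ps rest → xs ≡ ps ++ rest → P ps → P (ps ++ rest)
  go ps []       _     Pps = subst P (sym (++-identityʳ ps)) Pps
  go ps (x ∷ qs) xs≡ Pps = subst P (++-assoc ps (x ∷ []) qs)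
    (go (ps ∷ʳ x) qs (trans xs≡ (sym (++-assoc ps (x ∷ []) qs))) (extend ps x qs xs≡ Pps))

Reach-snoc : ∀ {n} {E : Subset n → Set} {a b c} → Reach E a b → E (⁅ b ⁆ ∪ ⁅ c ⁆) → Reach E a c
Reach-snoc here          e = step e here
Reach-snoc (step e′ a→b) e = step e′ (Reach-snoc a→b e)

Adjacent : ∀ {n} → (Subset n → Set) → Fin n → Fin n → Set
Adjacent T x y = ∃[ ρ ] (T ρ × x ∈ ρ × y ∈ ρ)

Adjacent-sym : ∀ {n} {T : Subset n → Set} {x y} → Adjacent T x y → Adjacent T y x
Adjacent-sym (ρ , Tρ , x∈ρ , y∈ρ) = ρ , Tρ , y∈ρ , x∈ρ

Adjacent-mono : ∀ {n} {T U : Subset n → Set} → (∀ {ρ} → T ρ → U ρ) →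
  ∀ {x y} → Adjacent T x y → Adjacent U x y
Adjacent-mono T⊆U (ρ , Tρ , x∈ρ , y∈ρ) = ρ , T⊆U Tρ , x∈ρ , y∈ρ

Triangle : ∀ {n} → Complex n → Subset n → Set
Triangle K σ = face K σ × ∣ σ ∣ ≡ 3

AtMostTwoDimensional : ∀ {n} → Complex n → Set
AtMostTwoDimensional K = ∀ σ → face K σ → ∣ σ ∣ ≤ 3

delete-atMostTwoDimensional : ∀ {n} {K : Complex n} {v} →
  AtMostTwoDimensional K → AtMostTwoDimensional (delete K v)
delete-atMostTwoDimensional dim σ (_ , fσ) = dim σ fσ

module _ {n} {K : Complex n} (dim : AtMostTwoDimensional K) where

  triangle⇒facet : ∀ {σ} → Triangle K σ → Facet K σ
  triangle⇒facet (fσ , ∣σ∣≡3) = fσ , λ τ fτ σ⊆τ →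
    ⊆-antisym (p⊆q∧∣q∣≤∣p∣⇒q⊆p σ⊆τ (subst (_ ≤_) (sym ∣σ∣≡3) (dim τ fτ))) σ⊆τ

  facet⊇edge-of-triangle⇒triangle : ∀ {ρ σ e} → Facet K ρ → Triangle K σ →
    ∣ e ∣ ≡ 2 → e ⊆ ρ → e ⊆ σ → ∣ ρ ∣ ≡ 3
  facet⊇edge-of-triangle⇒triangle {ρ} {σ} {e} (fρ , ρ-max) (fσ , ∣σ∣≡3) ∣e∣≡2 e⊆ρ e⊆σ with ∣ ρ ∣ ≤? 2
  ... | no  ∣ρ∣≰2 = ≤-antisym (dim ρ fρ) (≰⇒> ∣ρ∣≰2)
  ... | yes ∣ρ∣≤2 = contradiction (subst (_≤ 2) (trans (cong ∣_∣ (sym σ≡ρ)) ∣σ∣≡3) ∣ρ∣≤2) λ { (s≤s (s≤s ())) }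
    where
    ρ⊆e : ρ ⊆ e
    ρ⊆e = p⊆q∧∣q∣≤∣p∣⇒q⊆p e⊆ρ (subst (_ ≤_) (sym ∣e∣≡2) ∣ρ∣≤2)
    σ≡ρ : σ ≡ ρ
    σ≡ρ = ρ-max σ fσ (⊆-trans ρ⊆e e⊆σ)

Earlier : ∀ {n} → List (Subset n) → Fin n → Set
Earlier ps x = Any (x ∈_) ps

PrefixTriangle : ∀ {n} → Complex n → List (Subset n) → Subset n → Set
PrefixTriangle K ps ρ = ρ List.∈ ps × Triangle K ρ

module ShellingStep {n} {K : Complex n} (sh : Shelling K)
                    {ps σ qs} (order≡ : Shelling.order sh ≡ ps ++ σ ∷ qs) where
  open Shelling sh

  earlier-facet : ∀ {ρ} → ρ List.∈ ps → Facet K ρ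
  earlier-facet {ρ} ρ∈ps = facets⊆ ρ (subst (ρ List.∈_) (sym order≡) (∈-++⁺ˡ ρ∈ps))

  current-facet : Facet K σ
  current-facet = facets⊆ σ (subst (σ List.∈_) (sym order≡) (∈-++⁺ʳ ps (here refl)))

  wrong-size-extends : ∀ {τ} → PrefixIntersection ps σ τ → ∣ τ ∣ ≢ ∣ σ ∣ ∸ 1 →
    ∃[ z ] (z ∈ σ × z ∉ τ × Any (τ ∪ ⁅ z ⁆ ⊆_) ps)
  wrong-size-extends {τ} τ∈∩@(τ⊆σ , τ⊆earlier) ∣τ∣≢
    with any? (λ z → z ∈? σ ×-dec ¬? (z ∈? τ) ×-dec Any.any? ((τ ∪ ⁅ z ⁆) ⊆?_) ps)
  ... | yes extension = extension
  ... | no  ¬extension = contradiction (condition ps σ qs order≡ ps≢[] τ (τ∈∩ , τ-max)) ∣τ∣≢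
    where
    ps≢[] : ps ≢ []
    ps≢[] ps≡[] = ¬Any[] (subst (Any (τ ⊆_)) ps≡[] τ⊆earlier)
    τ-max : ∀ τ′ → PrefixIntersection ps σ τ′ → τ ⊆ τ′ → τ′ ≡ τ
    τ-max τ′ (τ′⊆σ , τ′⊆earlier) τ⊆τ′ = ⊆-antisym τ′⊆τ τ⊆τ′
      where
      τ′⊆τ : τ′ ⊆ τ
      τ′⊆τ {z} z∈τ′ with z ∈? τ
      ... | yes z∈τ = z∈τ
      ... | no  z∉τ = contradiction (z , τ′⊆σ z∈τ′ , z∉τ , Any.map τ∪⁅z⁆⊆ τ′⊆earlier) ¬extension
        where
        τ∪⁅z⁆⊆ : ∀ {ρ} → τ′ ⊆ ρ → τ ∪ ⁅ z ⁆ ⊆ ρ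
        τ∪⁅z⁆⊆ τ′⊆ρ = ∪-least (⊆-trans τ⊆τ′ τ′⊆ρ) (x∈p⇒⁅x⁆⊆p (τ′⊆ρ z∈τ′))

  module _ (dim : AtMostTwoDimensional K) (∣σ∣≡3 : ∣ σ ∣ ≡ 3) where

    meets-prefix : ∀ {ρ} → ρ List.∈ ps → ∃[ x ] (x ∈ σ × Earlier ps x)
    meets-prefix {ρ} ρ∈ps with wrong-size-extends (⊥⊆ , Any.map ⊥⊆-any ρ∈ps) ∣⊥∣≢2
      where
      ⊥⊆-any : ∀ {ρ′} → ρ ≡ ρ′ → ⊥ ⊆ ρ′
      ⊥⊆-any _ = ⊥⊆
      ∣⊥∣≢2 : ∣ ⊥ {n = n} ∣ ≢ ∣ σ ∣ ∸ 1
      ∣⊥∣≢2 rewrite ∣⊥∣≡0 n | ∣σ∣≡3 = λ ()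
    ... | x , x∈σ , _ , ⊥∪⁅x⁆⊆earlier = x , x∈σ , Any.map (λ ⊆ρ → ⊆ρ (q⊆p∪q ⊥ ⁅ x ⁆ (x∈⁅x⁆ x))) ⊥∪⁅x⁆⊆earlier

    edge-in-prefix : ∀ {x} → x ∈ σ → Earlier ps x →
      ∃[ y ] (y ∈ σ × y ≢ x × Adjacent (PrefixTriangle K ps) x y)
    edge-in-prefix {x} x∈σ x-earlier
      with wrong-size-extends (x∈p⇒⁅x⁆⊆p x∈σ , Any.map x∈p⇒⁅x⁆⊆p x-earlier) ∣⁅x⁆∣≢2
      where
      ∣⁅x⁆∣≢2 : ∣ ⁅ x ⁆ ∣ ≢ ∣ σ ∣ ∸ 1
      ∣⁅x⁆∣≢2 rewrite ∣⁅x⁆∣≡1 x | ∣σ∣≡3 = λ ()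
    ... | y , y∈σ , y∉⁅x⁆ , xy⊆earlier with List.find xy⊆earlier
    ...   | ρ , ρ∈ps , xy⊆ρ = y , y∈σ , y≢x , ρ , (ρ∈ps , proj₁ ρ-facet , ∣ρ∣≡3) ,
                              xy⊆ρ (p⊆p∪q ⁅ y ⁆ (x∈⁅x⁆ x)) , xy⊆ρ (q⊆p∪q ⁅ x ⁆ ⁅ y ⁆ (x∈⁅x⁆ y))
      where
      y≢x : y ≢ x
      y≢x = x∉⁅y⁆⇒x≢y y∉⁅x⁆
      ρ-facet : Facet K ρ
      ρ-facet = earlier-facet ρ∈ps
      ∣ρ∣≡3 : ∣ ρ ∣ ≡ 3
      ∣ρ∣≡3 = facet⊇edge-of-triangle⇒triangle {K = K} dim ρ-facet (proj₁ current-facet , ∣σ∣≡3)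
                (x≢y⇒∣⁅x⁆∪⁅y⁆∣≡2 (λ x≡y → y≢x (sym x≡y))) xy⊆ρ
                (∪-least (x∈p⇒⁅x⁆⊆p x∈σ) (x∈p⇒⁅x⁆⊆p y∈σ))

module _ {n} {K : Complex n} (dim : AtMostTwoDimensional K) (sh : Shelling K) where
  open Shelling sh

  private
    TrianglesConnected : List (Subset n) → Set
    TrianglesConnected ps = ∀ {σ τ x y} → PrefixTriangle K ps σ → PrefixTriangle K ps τ →
      x ∈ σ → y ∈ τ → Star (Adjacent (Triangle K)) x y

    from-new-triangle : ∀ {ps σ qs} → order ≡ ps ++ σ ∷ qs → TrianglesConnected ps →
      ∀ {τ x y} → Triangle K σ → PrefixTriangle K ps τ → x ∈ σ → y ∈ τ → Star (Adjacent (Triangle K)) x y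
    from-new-triangle {σ = σ} order≡ connected tσ@(_ , ∣σ∣≡3) (τ∈ps , tτ) x∈σ y∈τ
      with ShellingStep.meets-prefix sh order≡ dim ∣σ∣≡3 τ∈ps
    ... | x₀ , x₀∈σ , x₀-earlier with ShellingStep.edge-in-prefix sh order≡ dim ∣σ∣≡3 x₀∈σ x₀-earlier
    ...   | _ , _ , _ , ρ , ρ-prefix , x₀∈ρ , _ =
            (σ , tσ , x∈σ , x₀∈σ) ◅ connected ρ-prefix (τ∈ps , tτ) x₀∈ρ y∈τ

    connected-step : ∀ ps σ qs → order ≡ ps ++ σ ∷ qs →
      TrianglesConnected ps → TrianglesConnected (ps ∷ʳ σ)
    connected-step ps σ qs order≡ connected (ρ₁∈ , tρ₁) (ρ₂∈ , tρ₂) x∈ρ₁ y∈ρ₂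
      with ∈-∷ʳ⁻ ps ρ₁∈ | ∈-∷ʳ⁻ ps ρ₂∈
    ... | inj₁ ρ₁∈ps | inj₁ ρ₂∈ps = connected (ρ₁∈ps , tρ₁) (ρ₂∈ps , tρ₂) x∈ρ₁ y∈ρ₂
    ... | inj₂ refl  | inj₂ refl  = (σ , tρ₁ , x∈ρ₁ , y∈ρ₂) ◅ ε
    ... | inj₂ refl  | inj₁ ρ₂∈ps = from-new-triangle order≡ connected tρ₁ (ρ₂∈ps , tρ₂) x∈ρ₁ y∈ρ₂
    ... | inj₁ ρ₁∈ps | inj₂ refl  =
      Star.reverse Adjacent-sym (from-new-triangle order≡ connected tρ₂ (ρ₁∈ps , tρ₁) y∈ρ₂ x∈ρ₁)

  shelling⇒triangles-connected : ∀ {σ τ x y} → Triangle K σ → Triangle K τ →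
    x ∈ σ → y ∈ τ → Star (Adjacent (Triangle K)) x y
  shelling⇒triangles-connected tσ tτ =
    prefix-induction TrianglesConnected (λ { (() , _) }) connected-step (in-order tσ) (in-order tτ)
    where
    in-order : ∀ {σ} → Triangle K σ → PrefixTriangle K order σ
    in-order {σ} tσ = ⊆facets σ (triangle⇒facet {K = K} dim tσ) , tσ

module Link {n} (Γ : Complex n) (v : Fin n) (dim : AtMostTwoDimensional Γ) where

  ConeTriangle : Subset n → Set
  ConeTriangle ρ = Triangle Γ ρ × v ∈ ρ

  common-edge⇒LinkNBEdge : ∀ {s t} → s ≢ t → Adjacent ConeTriangle s t →
    Adjacent (Triangle (delete Γ v)) s t → LinkNBEdge Γ v (⁅ s ⁆ ∪ ⁅ t ⁆)
  common-edge⇒LinkNBEdge {s} {t} s≢t (ρ , ((fρ , ∣ρ∣≡3) , v∈ρ) , s∈ρ , t∈ρ) (τ , ((v∉τ , fτ) , ∣τ∣≡3) , s∈τ , t∈τ) =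
    (v∉st , closed Γ (∪-least st⊆ρ (x∈p⇒⁅x⁆⊆p v∈ρ)) fρ) ,
    (closed Γ st⊆ρ fρ , x≢y⇒∣⁅x⁆∪⁅y⁆∣≡2 s≢t) ,
    ρ , τ , (λ ρ≡τ → v∉τ (subst (v ∈_) ρ≡τ v∈ρ)) , fρ , ∣ρ∣≡3 , st⊆ρ , fτ , ∣τ∣≡3 , st⊆τ
    where
    st⊆ρ : ⁅ s ⁆ ∪ ⁅ t ⁆ ⊆ ρ
    st⊆ρ = ∪-least (x∈p⇒⁅x⁆⊆p s∈ρ) (x∈p⇒⁅x⁆⊆p t∈ρ)
    st⊆τ : ⁅ s ⁆ ∪ ⁅ t ⁆ ⊆ τ
    st⊆τ = ∪-least (x∈p⇒⁅x⁆⊆p s∈τ) (x∈p⇒⁅x⁆⊆p t∈τ)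
    v∉st : v ∉ ⁅ s ⁆ ∪ ⁅ t ⁆
    v∉st v∈st = v∉τ (st⊆τ v∈st)

  LinkNBEdge⇒cone-triangle : ∀ {e} → LinkNBEdge Γ v e → ConeTriangle (e ∪ ⁅ v ⁆)
  LinkNBEdge⇒cone-triangle {e} ((v∉e , fe∪v) , (_ , ∣e∣≡2) , _) =
    (fe∪v , trans (∣p∪⁅x⁆∣≡1+∣p∣ e v∉e) (cong suc ∣e∣≡2)) , q⊆p∪q e ⁅ v ⁆ (x∈⁅x⁆ v)

  LinkNBEdge⇒deletion-triangle : ∀ {e} → LinkNBEdge Γ v e → ∃[ τ ] (Triangle (delete Γ v) τ × e ⊆ τ)
  LinkNBEdge⇒deletion-triangle {e} e-nb@(_ , _ , σ₁ , σ₂ , σ₁≢σ₂ , fσ₁ , ∣σ₁∣≡3 , e⊆σ₁ , fσ₂ , ∣σ₂∣≡3 , e⊆σ₂)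
    with v ∈? σ₁ | v ∈? σ₂
  ... | no  v∉σ₁ | _        = σ₁ , ((v∉σ₁ , fσ₁) , ∣σ₁∣≡3) , e⊆σ₁
  ... | yes _    | no  v∉σ₂ = σ₂ , ((v∉σ₂ , fσ₂) , ∣σ₂∣≡3) , e⊆σ₂
  ... | yes v∈σ₁ | yes v∈σ₂ = contradiction (trans (is-cone fσ₁ e⊆σ₁ v∈σ₁) (sym (is-cone fσ₂ e⊆σ₂ v∈σ₂))) σ₁≢σ₂
    where
    is-cone : ∀ {σ} → face Γ σ → e ⊆ σ → v ∈ σ → σ ≡ e ∪ ⁅ v ⁆
    is-cone {σ} fσ e⊆σ v∈σ =
      proj₂ (triangle⇒facet {K = Γ} dim (proj₁ (LinkNBEdge⇒cone-triangle e-nb))) σ fσ (∪-least e⊆σ (x∈p⇒⁅x⁆⊆p v∈σ))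

  Apex : List (Subset n) → Subset n → Set
  Apex ps ρ = PrefixTriangle Γ ps ρ × v ∈ ρ

  Base : List (Subset n) → Subset n → Set
  Base ps ρ = PrefixTriangle Γ ps ρ × v ∉ ρ

  apex⇒cone : ∀ {ps ρ} → Apex ps ρ → ConeTriangle ρ
  apex⇒cone ((_ , tρ) , v∈ρ) = tρ , v∈ρ

  base⇒deletion-triangle : ∀ {ps ρ} → Base ps ρ → Triangle (delete Γ v) ρ
  base⇒deletion-triangle ((_ , fρ , ∣ρ∣≡3) , v∉ρ) = (v∉ρ , fρ) , ∣ρ∣≡3

  apex-or-base : ∀ {ps x y} → Adjacent (PrefixTriangle Γ ps) x y →
    Adjacent (Apex ps) x y ⊎ Adjacent (Base ps) x y
  apex-or-base (ρ , tρ , x∈ρ , y∈ρ) with v ∈? ρ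
  ... | yes v∈ρ = inj₁ (ρ , (tρ , v∈ρ) , x∈ρ , y∈ρ)
  ... | no  v∉ρ = inj₂ (ρ , (tρ , v∉ρ) , x∈ρ , y∈ρ)

  prefix-shrink : ∀ {ps σ ρ} → PrefixTriangle Γ (ps ∷ʳ σ) ρ → PrefixTriangle Γ ps ρ ⊎ ρ ≡ σ
  prefix-shrink {ps} (ρ∈ , tρ) with ∈-∷ʳ⁻ ps ρ∈
  ... | inj₁ ρ∈ps = inj₁ (ρ∈ps , tρ)
  ... | inj₂ ρ≡σ  = inj₂ ρ≡σ

  -- v itself counts as a link vertex; this is harmless since it lies on no base triangle.
  LinkVertex : List (Subset n) → Fin n → Set
  LinkVertex ps x = ∃[ ρ ] (Apex ps ρ × x ∈ ρ)

  OnBase : List (Subset n) → Fin n → Set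
  OnBase ps x = ∃[ ρ ] (Base ps ρ × x ∈ ρ)

  BasePath : List (Subset n) → Fin n → Fin n → Set
  BasePath ps = Star (Adjacent (Base ps))

  linkVertex⇒earlier : ∀ {ps x} → LinkVertex ps x → Earlier ps x
  linkVertex⇒earlier (_ , ((ρ∈ps , _) , _) , x∈ρ) = List.lose ρ∈ps x∈ρ

  linkVertex⇒apex-earlier : ∀ {ps x} → LinkVertex ps x → Earlier ps v
  linkVertex⇒apex-earlier (_ , ((ρ∈ps , _) , v∈ρ) , _) = List.lose ρ∈ps v∈ρ

  onBase⇒earlier : ∀ {ps x} → OnBase ps x → Earlier ps x
  onBase⇒earlier (_ , ((ρ∈ps , _) , _) , x∈ρ) = List.lose ρ∈ps x∈ρ

  onBase⇒≢apex : ∀ {ps x} → OnBase ps x → x ≢ v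
  onBase⇒≢apex (_ , (_ , v∉ρ) , x∈ρ) refl = v∉ρ x∈ρ

  basePath-ends : ∀ {ps w z} → BasePath ps w z → w ≡ z ⊎ (OnBase ps w × OnBase ps z)
  basePath-ends ε = inj₁ refl
  basePath-ends ((ρ , bρ , w∈ρ , y∈ρ) ◅ path) with basePath-ends path
  ... | inj₁ refl        = inj₂ ((ρ , bρ , w∈ρ) , (ρ , bρ , y∈ρ))
  ... | inj₂ (_ , on-z) = inj₂ ((ρ , bρ , w∈ρ) , on-z)

  LinkNBEdge⇒linkVertex : (sh : Shelling Γ) → ∀ {e x} → LinkNBEdge Γ v e → x ∈ e →
    LinkVertex (Shelling.order sh) x
  LinkNBEdge⇒linkVertex sh {e} e-nb x∈e =
    e ∪ ⁅ v ⁆ , ((Shelling.⊆facets sh _ (triangle⇒facet {K = Γ} dim tρ) , tρ) , v∈ρ) , p⊆p∪q ⁅ v ⁆ x∈e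
    where
    tρ : Triangle Γ (e ∪ ⁅ v ⁆)
    tρ = proj₁ (LinkNBEdge⇒cone-triangle e-nb)
    v∈ρ : v ∈ e ∪ ⁅ v ⁆
    v∈ρ = proj₂ (LinkNBEdge⇒cone-triangle e-nb)

  deletion-triangle⇒base : (sh : Shelling Γ) → ∀ {τ} → Triangle (delete Γ v) τ → Base (Shelling.order sh) τ
  deletion-triangle⇒base sh {τ} ((v∉τ , fτ) , ∣τ∣≡3) =
    (Shelling.⊆facets sh τ (triangle⇒facet {K = Γ} dim (fτ , ∣τ∣≡3)) , fτ , ∣τ∣≡3) , v∉τ

  module _ (a : Fin n) where

    Reachable : Fin n → Set
    Reachable = Reach (LinkNBEdge Γ v) a

    reach-across : ∀ {s t} → s ≢ t → Adjacent ConeTriangle s t →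
      Adjacent (Triangle (delete Γ v)) s t → Reachable s → Reachable t
    reach-across s≢t cone deletion reach-s = Reach-snoc reach-s (common-edge⇒LinkNBEdge s≢t cone deletion)

    Invariant : List (Subset n) → Set
    Invariant ps = ∀ {w z} → LinkVertex ps w → LinkVertex ps z → BasePath ps w z → Reachable w → Reachable z

    invariant-skip : ∀ {ps σ} → ∣ σ ∣ ≢ 3 → Invariant ps → Invariant (ps ∷ʳ σ)
    invariant-skip {ps} {σ} ∣σ∣≢3 inv (ρ , (pt , v∈ρ) , w∈ρ) (ρ′ , (pt′ , v∈ρ′) , z∈ρ′) path =
      inv (ρ , (old pt , v∈ρ) , w∈ρ) (ρ′ , (old pt′ , v∈ρ′) , z∈ρ′)
          (Star.map (Adjacent-mono λ (pt , v∉ρ) → old pt , v∉ρ) path)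
      where
      old : ∀ {ρ} → PrefixTriangle Γ (ps ∷ʳ σ) ρ → PrefixTriangle Γ ps ρ
      old pt with prefix-shrink pt
      ... | inj₁ pt-old = pt-old
      ... | inj₂ refl   = contradiction (proj₂ (proj₂ pt)) ∣σ∣≢3

    module _ (sh : Shelling Γ) where
      open Shelling sh

      module ApexStep {ps σ qs} (order≡ : order ≡ ps ++ σ ∷ qs) (∣σ∣≡3 : ∣ σ ∣ ≡ 3) (v∈σ : v ∈ σ)
                      (inv : Invariant ps) where
        open ShellingStep sh order≡

        σ-cone : ConeTriangle σ
        σ-cone = (proj₁ current-facet , ∣σ∣≡3) , v∈σ

        linkVertex-split : ∀ {x} → LinkVertex (ps ∷ʳ σ) x → LinkVertex ps x ⊎ x ∈ σ
        linkVertex-split (ρ , (pt , v∈ρ) , x∈ρ) with prefix-shrink pt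
        ... | inj₁ pt-old = inj₁ (ρ , (pt-old , v∈ρ) , x∈ρ)
        ... | inj₂ refl   = inj₂ x∈ρ

        basePath-old : ∀ {x y} → BasePath (ps ∷ʳ σ) x y → BasePath ps x y
        basePath-old = Star.map (Adjacent-mono old)
          where
          old : ∀ {ρ} → Base (ps ∷ʳ σ) ρ → Base ps ρ
          old (pt , v∉ρ) with prefix-shrink pt
          ... | inj₁ pt-old = pt-old , v∉ρ
          ... | inj₂ refl   = contradiction v∈σ v∉ρ

        record Partner (x y : Fin n) : Set where
          field
            base-edge : Adjacent (Base ps) x y
            forward   : Reachable x → Reachable y
            backward  : Reachable y → Reachable x
            spans     : ∀ {z} → z ∈ σ → z ≡ v ⊎ z ≡ x ⊎ z ≡ y

        partner : ∀ {x} → x ∈ σ → OnBase ps x → LinkVertex ps x ⊎ ∃[ y ] Partner x y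
        partner {x} x∈σ on-x with edge-in-prefix dim ∣σ∣≡3 x∈σ (onBase⇒earlier on-x)
        ... | y , y∈σ , y≢x , xy with apex-or-base xy
        ...   | inj₁ (ρ , apex , x∈ρ , _) = inj₁ (ρ , apex , x∈ρ)
        ...   | inj₂ xy-base@(ρ , (_ , v∉ρ) , _ , y∈ρ) = inj₂ (y , record
                  { base-edge = xy-base
                  ; forward   = reach-across x≢y (σ , σ-cone , x∈σ , y∈σ) (Adjacent-mono base⇒deletion-triangle xy-base)
                  ; backward  = reach-across y≢x (σ , σ-cone , y∈σ , x∈σ)
                                  (Adjacent-mono base⇒deletion-triangle (Adjacent-sym xy-base))
                  ; spans     = ∣p∣≤3⇒elements (dim σ (proj₁ current-facet)) v∈σ x∈σ y∈σ
                                  (λ v≡x → onBase⇒≢apex on-x (sym v≡x)) (λ v≡y → v∉ρ (subst (_∈ ρ) (sym v≡y) y∈ρ)) x≢y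
                  })
          where
          x≢y : x ≢ y
          x≢y x≡y = y≢x (sym x≡y)

        Anchored : Fin n → Set
        Anchored x = ∃[ x̂ ] (LinkVertex ps x̂ × BasePath ps x x̂ ×
                             (Reachable x → Reachable x̂) × (Reachable x̂ → Reachable x))

        anchored-at-itself : ∀ {x} → LinkVertex ps x → Anchored x
        anchored-at-itself {x} lx = x , lx , ε , id , id

        -- Some earlier apex triangle shares an edge v y′ with σ = {v, x, y}, and y′ is x or y.
        anchor : Earlier ps v → ∀ {x} → LinkVertex (ps ∷ʳ σ) x → OnBase ps x → Anchored x
        anchor v-earlier lx on-x with linkVertex-split lx
        ... | inj₁ lx-old = anchored-at-itself lx-old
        ... | inj₂ x∈σ with partner x∈σ on-x
        ...   | inj₁ lx-old = anchored-at-itself lx-old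
        ...   | inj₂ (y , p) with edge-in-prefix dim ∣σ∣≡3 v∈σ v-earlier
        ...     | y′ , y′∈σ , y′≢v , (ρ , pt , v∈ρ , y′∈ρ) with Partner.spans p y′∈σ
        ...       | inj₁ y′≡v        = contradiction y′≡v y′≢v
        ...       | inj₂ (inj₁ refl) = anchored-at-itself (ρ , (pt , v∈ρ) , y′∈ρ)
        ...       | inj₂ (inj₂ refl) = y′ , (ρ , (pt , v∈ρ) , y′∈ρ) , Partner.base-edge p ◅ ε ,
                                       Partner.forward p , Partner.backward p

        without-earlier-apex : ¬ Earlier ps v → ∀ {x z} → x ∈ σ → OnBase ps x → z ∈ σ → z ≢ v →
          Reachable x → Reachable z
        without-earlier-apex ¬v-earlier x∈σ on-x z∈σ z≢v with partner x∈σ on-x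
        ... | inj₁ lx-old = contradiction (linkVertex⇒apex-earlier lx-old) ¬v-earlier
        ... | inj₂ (y , p) with Partner.spans p z∈σ
        ...   | inj₁ z≡v        = contradiction z≡v z≢v
        ...   | inj₂ (inj₁ refl) = id
        ...   | inj₂ (inj₂ refl) = Partner.forward p

        invariant-apex : Invariant (ps ∷ʳ σ)
        invariant-apex lw lz path reach-w with basePath-ends (basePath-old path)
        ... | inj₁ refl = reach-w
        ... | inj₂ (on-w , on-z) with Any.any? (v ∈?_) ps
        ...   | yes v-earlier with anchor v-earlier lw on-w | anchor v-earlier lz on-z
        ...     | ŵ , lŵ , w→ŵ , reach-ŵ , _ | ẑ , lẑ , z→ẑ , _ , reach-z =
                  reach-z (inv lŵ lẑ (Star.reverse Adjacent-sym w→ŵ ◅◅ basePath-old path ◅◅ z→ẑ) (reach-ŵ reach-w))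
        invariant-apex lw lz path reach-w | inj₂ (on-w , on-z) | no ¬v-earlier
          with linkVertex-split lw | linkVertex-split lz
        ... | inj₁ lw-old | _           = contradiction (linkVertex⇒apex-earlier lw-old) ¬v-earlier
        ... | inj₂ _      | inj₁ lz-old = contradiction (linkVertex⇒apex-earlier lz-old) ¬v-earlier
        ... | inj₂ w∈σ    | inj₂ z∈σ    = without-earlier-apex ¬v-earlier w∈σ on-w z∈σ (onBase⇒≢apex on-z) reach-w

      module BaseStep {ps σ qs} (order≡ : order ≡ ps ++ σ ∷ qs) (∣σ∣≡3 : ∣ σ ∣ ≡ 3) (v∉σ : v ∉ σ)
                      (inv : Invariant ps) where
        open ShellingStep sh order≡

        σ-deletion : Triangle (delete Γ v) σ
        σ-deletion = (v∉σ , proj₁ current-facet) , ∣σ∣≡3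

        linkVertex-old : ∀ {x} → LinkVertex (ps ∷ʳ σ) x → LinkVertex ps x
        linkVertex-old (ρ , (pt , v∈ρ) , x∈ρ) with prefix-shrink pt
        ... | inj₁ pt-old = ρ , (pt-old , v∈ρ) , x∈ρ
        ... | inj₂ refl   = contradiction v∈ρ v∉σ

        base-split : ∀ {x y} → Adjacent (Base (ps ∷ʳ σ)) x y → Adjacent (Base ps) x y ⊎ (x ∈ σ × y ∈ σ)
        base-split (ρ , (pt , v∉ρ) , x∈ρ , y∈ρ) with prefix-shrink pt
        ... | inj₁ pt-old = inj₁ (ρ , (pt-old , v∉ρ) , x∈ρ , y∈ρ)
        ... | inj₂ refl   = inj₂ (x∈ρ , y∈ρ)

        Tethered : Fin n → Set
        Tethered z = ∃[ u ] (LinkVertex ps u × Reachable u × BasePath ps u z)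

        tethered⇒reachable : ∀ {z} → Tethered z → LinkVertex ps z → Reachable z
        tethered⇒reachable (_ , lu , reach-u , path) lz = inv lu lz path reach-u

        tethered⇒earlier : ∀ {z} → Tethered z → Earlier ps z
        tethered⇒earlier (_ , lu , _ , path) with basePath-ends path
        ... | inj₁ refl       = linkVertex⇒earlier lu
        ... | inj₂ (_ , on-z) = onBase⇒earlier on-z

        tethered-extend : ∀ {x y} → Tethered x → Adjacent (Base ps) x y → Tethered y
        tethered-extend (u , lu , reach-u , path) xy = u , lu , reach-u , path ◅◅ xy ◅ ε

        tethered-across : ∀ {x y} → Tethered x → x ∈ σ → y ∈ σ → x ≢ y →
          Adjacent (PrefixTriangle Γ ps) x y → Tethered y
        tethered-across tx x∈σ y∈σ x≢y xy with apex-or-base xy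
        ... | inj₂ xy-base = tethered-extend tx xy-base
        ... | inj₁ xy-apex@(ρ , apex , x∈ρ , y∈ρ) =
          _ , (ρ , apex , y∈ρ) ,
          reach-across x≢y (Adjacent-mono apex⇒cone xy-apex) (σ , σ-deletion , x∈σ , y∈σ)
            (tethered⇒reachable tx (ρ , apex , x∈ρ)) ,
          ε

        -- The shelled part of σ is a pure 1-dimensional complex on at most three vertices, hence connected.
        tethered-spreads : ∀ {z s} → Tethered z → z ∈ σ → s ∈ σ → Earlier ps s → Tethered s
        tethered-spreads {z} {s} tz z∈σ s∈σ s-earlier with s ≟ᶠ z
        ... | yes refl = tz
        ... | no  s≢z with edge-in-prefix dim ∣σ∣≡3 s∈σ s-earlier
        ...   | t , t∈σ , t≢s , st with t ≟ᶠ z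
        ...     | yes refl = tethered-across tz t∈σ s∈σ t≢s (Adjacent-sym st)
        ...     | no  t≢z with edge-in-prefix dim ∣σ∣≡3 z∈σ (tethered⇒earlier tz)
        ...       | t′ , t′∈σ , t′≢z , zt′
                    with ∣p∣≤3⇒elements (dim σ (proj₁ current-facet)) z∈σ s∈σ t∈σ
                           (λ z≡s → s≢z (sym z≡s)) (λ z≡t → t≢z (sym z≡t)) (λ s≡t → t≢s (sym s≡t)) t′∈σ
        ...         | inj₁ t′≡z        = contradiction t′≡z t′≢z
        ...         | inj₂ (inj₁ refl) = tethered-across tz z∈σ s∈σ (λ z≡s → s≢z (sym z≡s)) zt′
        ...         | inj₂ (inj₂ refl) = tethered-across (tethered-across tz z∈σ t∈σ (λ z≡t → t≢z (sym z≡t)) zt′)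
                                           t∈σ s∈σ t≢s (Adjacent-sym st)

        Spread : Set
        Spread = ∀ {s} → s ∈ σ → Earlier ps s → Tethered s

        WalkState : Fin n → Set
        WalkState x = Tethered x ⊎ (x ∈ σ × Spread)

        walk-step : ∀ {x y} → Adjacent (Base (ps ∷ʳ σ)) x y → WalkState x → WalkState y
        walk-step xy state with base-split xy | state
        ... | inj₁ xy-old | inj₁ tx = inj₁ (tethered-extend tx xy-old)
        ... | inj₁ xy-old@(ρ , ((ρ∈ps , _) , _) , x∈ρ , _) | inj₂ (x∈σ , spread) =
          inj₁ (tethered-extend (spread x∈σ (List.lose ρ∈ps x∈ρ)) xy-old)
        ... | inj₂ (x∈σ , y∈σ) | inj₁ tx          = inj₂ (y∈σ , λ s∈σ → tethered-spreads tx x∈σ s∈σ)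
        ... | inj₂ (_ , y∈σ)   | inj₂ (_ , spread) = inj₂ (y∈σ , spread)

        walk : ∀ {x y} → BasePath (ps ∷ʳ σ) x y → WalkState x → WalkState y
        walk ε           state = state
        walk (xy ◅ path) state = walk path (walk-step xy state)

        invariant-base : Invariant (ps ∷ʳ σ)
        invariant-base {w} lw lz path reach-w with walk path (inj₁ (w , linkVertex-old lw , reach-w , ε))
        ... | inj₁ tz             = tethered⇒reachable tz (linkVertex-old lz)
        ... | inj₂ (z∈σ , spread) =
          tethered⇒reachable (spread z∈σ (linkVertex⇒earlier (linkVertex-old lz))) (linkVertex-old lz)

      invariant : Invariant order
      invariant = prefix-induction Invariant (λ { (_ , ((() , _) , _) , _) }) invariant-step
        where
        invariant-step : ∀ ps σ qs → order ≡ ps ++ σ ∷ qs → Invariant ps → Invariant (ps ∷ʳ σ)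
        invariant-step ps σ qs order≡ inv with ∣ σ ∣ ≟ 3 | v ∈? σ
        ... | no  ∣σ∣≢3 | _       = invariant-skip ∣σ∣≢3 inv
        ... | yes ∣σ∣≡3 | yes v∈σ = ApexStep.invariant-apex order≡ ∣σ∣≡3 v∈σ inv
        ... | yes ∣σ∣≡3 | no  v∉σ = BaseStep.invariant-base order≡ ∣σ∣≡3 v∉σ inv

lemma2p15 : ∀ {n} (Γ : Complex n) (v : Fin n) →
    TwoDimensional Γ →
    (∃[ e ] LinkNBEdge Γ v e) →
    Shellable (delete Γ v) →
    ¬ Connected (LinkNBEdge Γ v) →
    ¬ Shellable Γ
lemma2p15 Γ v (_ , dim) _ shelling-Γ∖v ¬connected shelling-Γ = ¬connected connected
  where
  open Link Γ v dim
  connected : Connected (LinkNBEdge Γ v)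
  connected a b (_ , e-nb , a∈e) (_ , f-nb , b∈f)
    with LinkNBEdge⇒deletion-triangle e-nb | LinkNBEdge⇒deletion-triangle f-nb
  ... | _ , tτ , e⊆τ | _ , tτ′ , f⊆τ′ =
    invariant a shelling-Γ (LinkNBEdge⇒linkVertex shelling-Γ e-nb a∈e)
      (LinkNBEdge⇒linkVertex shelling-Γ f-nb b∈f) (Star.map (Adjacent-mono (deletion-triangle⇒base shelling-Γ)) a⇝b) here
    where
    a⇝b : Star (Adjacent (Triangle (delete Γ v))) a b
    a⇝b = shelling⇒triangles-connected (delete-atMostTwoDimensional {K = Γ} dim) shelling-Γ∖v
            tτ tτ′ (e⊆τ a∈e) (f⊆τ′ b∈f)
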